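{- Let $k\geq1$, let $G_i=(V_i,E_i)$ ($1\le i\le k$) and $H=(V_H,E_H)$ be pairwise vertex-disjoint, connected graphs, each with at least two vertices, let $u_i\in V_i$ and $v_1,\dots,v_k\in V_H$ (not necessarily distinct), let $J=G_{1,\ldots,k}\circ^{u_1,\dots,u_k}_{v_1,\dots,v_k}H$, and let $w\in V_H$. Define $$U_0=\mathrm{MVC}\bigl(\mathrm{SR}(H)\setminus\{v_1,\dots,v_k,w\}\bigr)\cup\bigcup_{1\le i\le k}\mathrm{XVC}\bigl(\mathrm{SR}(G_i)\setminus\{u_i\},\ \mathrm{MD}_{G_i}(u_i)\bigr)$$ and, for $j=1,\dots,k$, $$U_j=\mathrm{XVC}\bigl(\mathrm{SR}(H)\setminus\{v_1,\dots,v_k,w\},\ \mathrm{MD}_H(v_j)\setminus\{v_1,\dots,v_k,w\}\bigr)\cup\mathrm{MVC}\bigl(\mathrm{SR}(G_j)\setminus\{u_j\}\bigr)\cup\bigcup_{1\le i\le k,\ i\ne j}\mathrm{XVC}\bigl(\mathrm{SR}(G_i)\setminus\{u_i\},\ \mathrm{MD}_{G_i}(u_i)\bigr),$$ where each $\mathrm{MVC}(\cdot)$ and $\mathrm{XVC}(\cdot,\cdot)$ denotes an arbitrary set with the defining property. Then each of $U_0,U_1,\dots,U_k$ is a vertex cover of $\mathrm{SR}(J)\setminus\{w\}$, and at least one of them is a minimum vertex cover of $\mathrm{SR}(J)\setminus\{w\}$.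
   Context: All graphs are finite, undirected and simple. In a connected graph $G$, $d_G(x,y)$ is the distance and $N_G(x)$ the set of neighbours of $x$. A vertex $u$ is maximally distant from $w$ in $G$ if there is no $v\in N_G(u)$ with $d_G(v,w)>d_G(u,w)$; $\mathrm{MD}_G(u)$ is the set of vertices maximally distant from $u$ in $G$; two vertices are mutually maximally distant if each is maximally distant from the other. The strong resolving graph $\mathrm{SR}(G)$ has the vertex set of $G$, with an edge between distinct $u,v$ iff they are mutually maximally distant in $G$. For a graph $F$ and vertex set $X$, $F\setminus X$ denotes $F$ with the vertices of $X$ and their incident edges deleted. $\mathrm{MVC}(F)$ denotes a minimum-cardinality vertex cover of $F$; for a vertex set $M$ of $F$, $\mathrm{XVC}(F,M)$ denotes a vertex cover of $F$ that contains $M$ and has minimum cardinality among all vertex covers of $F$ containing $M$. The composed graph $J=G_{1,\ldots,k}\circ^{u_1,\dots,u_k}_{v_1,\dots,v_k}H$ has vertex set $(V_1\cup\dots\cup V_k\cup V_H)\setminus\{u_1,\dots,u_k\}$ and edge set $(E_1\cup\dots\cup E_k\cup E_H\cup\{\{x,v_i\}: x\in N_{G_i}(u_i),1\le i\le k\})\setminus\{\{x,u_i\}: x\in N_{G_i}(u_i),1\le i\le k\}$; i.e. $J$ is obtained by identifying each $u_i$ with $v_i$. -}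

module Defs where

open import Data.Nat using (ℕ; zero; suc; _≤_; _<_)
open import Data.Fin using (Fin; zero; suc; _≟_)
open import Data.Bool using (Bool; true; false; T)
open import Data.List using (List; []; _∷_; length; map; _++_; concatMap; mapMaybe; allFin)
open import Data.List.Membership.Propositional using (_∈_)
open import Data.List.Relation.Unary.Unique.Propositional using (Unique)
open import Data.Maybe using (Maybe; just; nothing)
open import Data.Product using (Σ; Σ-syntax; ∃; _×_; _,_)
open import Data.Sum using (_⊎_; inj₁; inj₂)
open import Relation.Nullary using (¬_; yes; no)
open import Relation.Nullary.Decidable using (False; fromWitnessFalse)
open import Relation.Binary.PropositionalEquality using (_≡_; _≢_)

record Graph (n : ℕ) : Set where
  field
    adj    : Fin n → Fin n → Bool
    sym    : ∀ x y → adj x y ≡ adj y x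
    irrefl : ∀ x → adj x x ≡ false

Edge : ∀ {n} → Graph n → Fin n → Fin n → Set
Edge G x y = T (Graph.adj G x y)

module _ {V : Set} (Adj : V → V → Set) where

  data Walk : V → V → ℕ → Set where
    nil  : ∀ x → Walk x x zero
    cons : ∀ {x y z m} → Adj x y → Walk y z m → Walk x z (suc m)

  Connected : Set
  Connected = ∀ x y → ∃ λ d → Walk x y d

  IsDist : V → V → ℕ → Set
  IsDist x y d = Walk x y d × (∀ m → Walk x y m → d ≤ m)

  MaxDistFrom : V → V → Set
  MaxDistFrom u w =
    ¬ (Σ[ v ∈ V ] Σ[ dv ∈ ℕ ] Σ[ du ∈ ℕ ]
         (Adj u v × IsDist v w dv × IsDist u w du × du < dv))

  MD : V → V → Set
  MD u x = MaxDistFrom x u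

  SREdge : V → V → Set
  SREdge x y = x ≢ y × MaxDistFrom x y × MaxDistFrom y x

  IsVC : (V → Set) → List V → Set
  IsVC X C = (∀ x → x ∈ C → ¬ X x)
           × (∀ x y → ¬ X x → ¬ X y → SREdge x y → x ∈ C ⊎ y ∈ C)

  IsMinVC : (V → Set) → List V → Set
  IsMinVC X C = IsVC X C × (∀ C' → IsVC X C' → length C ≤ length C')

  IsMVC : (V → Set) → List V → Set
  IsMVC X C = Unique C × IsMinVC X C

  IsXVC : (V → Set) → (V → Set) → List V → Set
  IsXVC X M C = Unique C × IsVC X C × (∀ x → M x → x ∈ C)
              × (∀ C' → IsVC X C' → (∀ x → M x → x ∈ C') → length C ≤ length C')

module Compose (k : ℕ) (n : Fin k → ℕ) (G : (i : Fin k) → Graph (n i))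
               (nH : ℕ) (H : Graph nH)
               (u : (i : Fin k) → Fin (n i)) (v : Fin k → Fin nH) where

  VJ : Set
  VJ = (Σ[ i ∈ Fin k ] Σ[ x ∈ Fin (n i) ] False (x ≟ u i)) ⊎ Fin nH

  data AdjJ : VJ → VJ → Set where
    inG   : ∀ i x y p q → Edge (G i) x y → AdjJ (inj₁ (i , x , p)) (inj₁ (i , y , q))
    inH   : ∀ a b → Edge H a b → AdjJ (inj₂ a) (inj₂ b)
    glueˡ : ∀ i x p → Edge (G i) x (u i) → AdjJ (inj₁ (i , x , p)) (inj₂ (v i))
    glueʳ : ∀ i x p → Edge (G i) x (u i) → AdjJ (inj₂ (v i)) (inj₁ (i , x , p))

  liftG : (i : Fin k) → Fin (n i) → Maybe VJ
  liftG i x with x ≟ u i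
  ... | yes _ = nothing
  ... | no  p = just (inj₁ (i , x , fromWitnessFalse p))

  liftGs : (i : Fin k) → List (Fin (n i)) → List VJ
  liftGs i = mapMaybe (liftG i)

VWSet : ∀ {k nH} → (Fin k → Fin nH) → Fin nH → Fin nH → Set
VWSet v w x = (∃ λ j → x ≡ v j) ⊎ x ≡ w

MDminus : ∀ {nH} → (Fin nH → Fin nH → Set) → Fin nH → (Fin nH → Set) → Fin nH → Set
MDminus A y X x = MD A y x × ¬ X x

-- The sets U_0 (t = zero) and U_j (t = suc j), given the chosen covers:
--   CH = MVC(SR(H)\X), DH j = XVC(SR(H)\X, MD_H(v_j)\X),
--   CG i = XVC(SR(G_i)\{u_i}, MD_{G_i}(u_i)), DG i = MVC(SR(G_i)\{u_i}).

module Covers (k : ℕ) (n : Fin k → ℕ) (G : (i : Fin k) → Graph (n i))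
              (nH : ℕ) (H : Graph nH)
              (u : (i : Fin k) → Fin (n i)) (v : Fin k → Fin nH)
              (CH : List (Fin nH)) (DH : Fin k → List (Fin nH))
              (CG DG : (i : Fin k) → List (Fin (n i))) where

  open Compose k n G nH H u v

  hList : Fin (suc k) → List (Fin nH)
  hList zero    = CH
  hList (suc j) = DH j

  gList : Fin (suc k) → (i : Fin k) → List (Fin (n i))
  gList zero    i = CG i
  gList (suc j) i with i ≟ j
  ... | yes _ = DG i
  ... | no  _ = CG i

  U : Fin (suc k) → List VJ
  U t = map inj₂ (hList t) ++ concatMap (λ i → liftGs i (gList t i)) (allFin k)

-- Distances in J are computed piecewise: inside a factor they are the factor's distances, and
-- every path leaving the side of G_i passes through v_i, so d_J(x, t) = d_{G_i}(x, u_i) + d_J(v_i, t).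
-- Hence mutual maximal distance in J is read off the factors: within one G_i it is that of G_i,
-- a vertex x of G_i and a vertex off its side can only be mutually maximally distant when
-- x ∈ MD_{G_i}(u_i) (and an H-vertex b only when b ∈ MD_H(v_i)), and the glued vertices v_l are
-- isolated in SR(J). This makes every U_t a cover. Conversely, a cover C of SR(J) \ {w} projects
-- onto covers of SR(H) \ X and of each SR(G_i) \ {u_i} of total size at most |C|. If C contains
-- all of every MD_{G_i}(u_i), these projections dominate the sets defining U_0; if C misses some
-- x ∈ MD_{G_j}(u_j), then all SR(J)-neighbours of x, among them MD_H(v_j) \ X and MD_{G_i}(u_i)
-- for i ≠ j, lie in C and the projections dominate the sets defining U_j.
-- So the shortest U_t is a minimum cover.

module Submission where

open import Defs
import Algebra.Properties.CommutativeMonoid.Sum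
open import Data.Bool using (T)
open import Data.Bool.Properties using (T?; T-irrelevant)
open import Data.Empty using (⊥; ⊥-elim)
open import Data.Fin using (Fin; zero; suc; _≟_; punchIn)
open import Data.Fin.Properties using (any?; punchInᵢ≢i; suc-injective)
open import Data.List using (List; []; _∷_; [_]; length; map; concatMap; mapMaybe; allFin; tabulate)
open import Data.List.Properties using (length-++; length-map; length-mapMaybe; mapMaybe-++)
open import Data.List.Extrema.Nat using (argmin; f[argmin]≤f[xs])
open import Data.List.Membership.Propositional using (_∈_; lose)
open import Data.List.Membership.Propositional.Properties
  using (∈-++⁺ˡ; ∈-++⁺ʳ; ∈-++⁻; ∈-map⁺; ∈-map⁻; ∈-concatMap⁺; ∈-concatMap⁻; ∈-allFin)
import Data.List.Relation.Unary.All as All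
open import Data.List.Relation.Unary.Any using (here; there; satisfied)
open import Data.Maybe using (Maybe; just; nothing; fromMaybe)
open import Data.Nat using (ℕ; zero; suc; _+_; _≤_; _<_; z≤n; s≤s; _≤?_)
open import Data.Nat.Induction using (<-rec)
open import Data.Nat.Properties
  using (≤-antisym; ≤-trans; ≤-reflexive; ≮⇒≥; <⇒≱; 1+n≰n; m≤n⇒m≤1+n; anyUpTo?;
         +-identityʳ; +-mono-≤; +-monoˡ-≤; +-monoʳ-≤; +-cancelˡ-≤; +-cancelʳ-≤;
         +-0-commutativeMonoid; +-commutativeSemigroup; module ≤-Reasoning)
import Data.Product.Properties as Product
open import Data.Product using (∃; ∃₂; _×_; _,_; proj₁; proj₂)
open import Data.Sum using (_⊎_; inj₁; inj₂)
import Data.Sum as Sum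
import Data.Sum.Properties as Sum
open import Function using (_∘_)
open import Relation.Binary.Definitions using (Symmetric; DecidableEquality)
open import Relation.Binary.PropositionalEquality
  using (_≡_; _≢_; refl; sym; trans; cong; cong₂; subst; subst₂; module ≡-Reasoning)
open import Relation.Nullary using (¬_; Dec; yes; no)
open import Relation.Nullary.Decidable
  using (False; fromWitnessFalse; toWitnessFalse; _×-dec_; _⊎-dec_; decidable-stable)
open import Relation.Unary using (Decidable)
open import Algebra.Properties.CommutativeSemigroup +-commutativeSemigroup using (interchange)

module ∑ = Algebra.Properties.CommutativeMonoid.Sum +-0-commutativeMonoid
open ∑ using (sum-syntax)

NoFarther : ∀ {V : Set} → (V → V → Set) → V → V → V → Set
NoFarther Adj s u w = ∃₂ λ ds du → IsDist Adj s w ds × IsDist Adj u w du × ds ≤ du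

module _ {V : Set} {Adj : V → V → Set} where

  _++ʷ_ : ∀ {x y z m m′} → Walk Adj x y m → Walk Adj y z m′ → Walk Adj x z (m + m′)
  nil _    ++ʷ q = q
  cons e p ++ʷ q = cons e (p ++ʷ q)

  _∷ʳʷ_ : ∀ {x y z m} → Walk Adj x y m → Adj y z → Walk Adj x z (suc m)
  nil _     ∷ʳʷ e = cons e (nil _)
  cons e′ p ∷ʳʷ e = cons e′ (p ∷ʳʷ e)

  walk-start : ∀ {x y m} → x ≢ y → Walk Adj x y m → ∃ (Adj x)
  walk-start x≢y (nil _)    = ⊥-elim (x≢y refl)
  walk-start x≢y (cons e _) = _ , e

  reverseʷ : Symmetric Adj → ∀ {x y m} → Walk Adj x y m → Walk Adj y x m
  reverseʷ adj-sym (nil x)    = nil x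
  reverseʷ adj-sym (cons e p) = reverseʷ adj-sym p ∷ʳʷ adj-sym e

  IsDist-refl : ∀ x → IsDist Adj x x 0
  IsDist-refl x = nil x , λ _ _ → z≤n

  IsDist-unique : ∀ {x y a b} → IsDist Adj x y a → IsDist Adj x y b → a ≡ b
  IsDist-unique (p , a-min) (q , b-min) = ≤-antisym (a-min _ q) (b-min _ p)

  IsDist-sym : Symmetric Adj → ∀ {x y d} → IsDist Adj x y d → IsDist Adj y x d
  IsDist-sym adj-sym (p , d-min) =
    reverseʷ adj-sym p , λ m q → d-min m (reverseʷ adj-sym q)

  maxDistFrom-≤ : ∀ {u w v dv du} → MaxDistFrom Adj u w →
                  Adj u v → IsDist Adj v w dv → IsDist Adj u w du → dv ≤ du
  maxDistFrom-≤ h e pv pu = ≮⇒≥ λ lt → h (_ , _ , _ , e , pv , pu , lt)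

  ≤⇒maxDistFrom : ∀ {u w} →
                  (∀ {v dv du} → Adj u v → IsDist Adj v w dv → IsDist Adj u w du → dv ≤ du) →
                  MaxDistFrom Adj u w
  ≤⇒maxDistFrom h (_ , _ , _ , e , pv , pu , lt) = <⇒≱ lt (h e pv pu)

  ∃≤⇒maxDistFrom : ∀ {u w} → (∀ {s} → Adj u s → NoFarther Adj s u w) → MaxDistFrom Adj u w
  ∃≤⇒maxDistFrom h = ≤⇒maxDistFrom λ e ps pu → bound (h e) ps pu
    where
    bound : ∀ {s u w ds du} → NoFarther Adj s u w →
            IsDist Adj s w ds → IsDist Adj u w du → ds ≤ du
    bound (_ , _ , ps′ , pu′ , le) ps pu =
      subst₂ _≤_ (IsDist-unique ps′ ps) (IsDist-unique pu′ pu) le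

module _ {V W : Set} {A : V → V → Set} {B : W → W → Set} (f : V → W) where

  walk-map : (∀ {a b} → A a b → B (f a) (f b)) →
             ∀ {x y m} → Walk A x y m → Walk B (f x) (f y) m
  walk-map hom (nil x)    = nil (f x)
  walk-map hom (cons e p) = cons (hom e) (walk-map hom p)

  walk-contract : (∀ {a b} → A a b → f a ≡ f b ⊎ B (f a) (f b)) →
                  ∀ {x y m} → Walk A x y m → ∃ λ m′ → m′ ≤ m × Walk B (f x) (f y) m′
  walk-contract contr (nil x) = 0 , z≤n , nil (f x)
  walk-contract contr (cons e p) with walk-contract contr p | contr e
  ... | m′ , le , q | inj₁ eq = m′ , m≤n⇒m≤1+n le , subst (λ z → Walk B z (f _) m′) (sym eq) q
  ... | m′ , le , q | inj₂ e′ = suc m′ , s≤s le , cons e′ q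

IsDist-retract : ∀ {V W : Set} {A : V → V → Set} {B : W → W → Set}
                 (e : V → W) (r : W → V) →
                 (∀ {a b} → A a b → B (e a) (e b)) →
                 (∀ {a b} → B a b → r a ≡ r b ⊎ A (r a) (r b)) →
                 (∀ x → r (e x) ≡ x) →
                 ∀ {x y d} → IsDist A x y d → IsDist B (e x) (e y) d
IsDist-retract {A = A} e r hom contr retract {x} {y} {d} (p , d-min) = walk-map e hom p , lower-bound
  where
  lower-bound : ∀ m → Walk _ (e x) (e y) m → d ≤ m
  lower-bound m q with walk-contract r contr q
  ... | m′ , m′≤m , q′ =
    ≤-trans (d-min m′ (subst₂ (λ a b → Walk A a b m′) (retract x) (retract y) q′)) m′≤m

∃-least : ∀ {P : ℕ → Set} → Decidable P → ∀ {d} → P d →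
          ∃ λ m → P m × (∀ {m′} → P m′ → m ≤ m′)
∃-least {P} P? {d} = <-rec Goal step d
  where
  Goal : ℕ → Set
  Goal d = P d → ∃ λ m → P m × (∀ {m′} → P m′ → m ≤ m′)

  step : ∀ d → (∀ {m} → m < d → Goal m) → Goal d
  step d rec pd with anyUpTo? P? d
  ... | yes (m , m<d , pm) = rec m<d pm
  ... | no none = d , pd , λ {m′} pm′ → ≮⇒≥ λ m′<d → none (m′ , m′<d , pm′)

module _ {n : ℕ} (G : Graph n) where

  Edge-sym : Symmetric (Edge G)
  Edge-sym {x} {y} = subst T (Graph.sym G x y)

  Edge-irrefl : ∀ {x} → ¬ Edge G x x
  Edge-irrefl {x} = subst T (Graph.irrefl G x)

  walk? : ∀ m x y → Dec (Walk (Edge G) x y m)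
  walk? zero x y with x ≟ y
  ... | yes refl = yes (nil x)
  ... | no x≢y   = no λ { (nil _) → x≢y refl }
  walk? (suc m) x y with any? (λ z → T? (Graph.adj G x z) ×-dec walk? m z y)
  ... | yes (z , e , p) = yes (cons e p)
  ... | no none         = no λ { (cons e p) → none (_ , e , p) }

  dist : Connected (Edge G) → ∀ x y → ∃ (IsDist (Edge G) x y)
  dist connected x y with ∃-least (λ m → walk? m x y) (proj₂ (connected x y))
  ... | d , p , d-min = d , p , λ m q → d-min q

  IsDist-edge : ∀ {x y} → Edge G x y → IsDist (Edge G) x y 1
  IsDist-edge {x} {y} e = cons e (nil y) , lower-bound
    where
    lower-bound : ∀ m → Walk (Edge G) x y m → 1 ≤ m
    lower-bound zero    (nil _) = ⊥-elim (Edge-irrefl e)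
    lower-bound (suc m) _       = s≤s z≤n

  neighbour : 2 ≤ n → Connected (Edge G) → ∀ x → ∃ (Edge G x)
  neighbour (s≤s (s≤s _)) connected zero    = walk-start (λ ()) (proj₂ (connected zero (suc zero)))
  neighbour (s≤s (s≤s _)) connected (suc x) = walk-start (λ ()) (proj₂ (connected (suc x) zero))

  not-maxDistFrom-self : 2 ≤ n → Connected (Edge G) → ∀ x → ¬ MaxDistFrom (Edge G) x x
  not-maxDistFrom-self n≥2 connected x h with neighbour n≥2 connected x
  ... | z , e = 1+n≰n (maxDistFrom-≤ h e (IsDist-edge (Edge-sym e)) (IsDist-refl x))

module _ {A B : Set} (f : A → Maybe B) where

  ∈-mapMaybe⁺ : ∀ {x y xs} → x ∈ xs → f x ≡ just y → y ∈ mapMaybe f xs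
  ∈-mapMaybe⁺ {xs = x ∷ _} (here refl) fx≡y rewrite fx≡y = here refl
  ∈-mapMaybe⁺ {xs = z ∷ _} (there x∈xs) fx≡y with f z
  ... | just _  = there (∈-mapMaybe⁺ x∈xs fx≡y)
  ... | nothing = ∈-mapMaybe⁺ x∈xs fx≡y

  ∈-mapMaybe⁻ : ∀ {y} xs → y ∈ mapMaybe f xs → ∃ λ x → x ∈ xs × f x ≡ just y
  ∈-mapMaybe⁻ (z ∷ xs) y∈ with f z in fz≡
  ∈-mapMaybe⁻ (z ∷ xs) (here refl) | just _ = z , here refl , fz≡
  ∈-mapMaybe⁻ (z ∷ xs) (there y∈)  | just _ with ∈-mapMaybe⁻ xs y∈
  ... | x , x∈xs , fx≡y = x , there x∈xs , fx≡y
  ∈-mapMaybe⁻ (z ∷ xs) y∈ | nothing with ∈-mapMaybe⁻ xs y∈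
  ... | x , x∈xs , fx≡y = x , there x∈xs , fx≡y

  length-mapMaybe-∷ : ∀ x xs →
                      length (mapMaybe f (x ∷ xs)) ≡ length (mapMaybe f [ x ]) + length (mapMaybe f xs)
  length-mapMaybe-∷ x xs =
    trans (cong length (mapMaybe-++ f [ x ] xs)) (length-++ (mapMaybe f [ x ]))

length-mapMaybe-nothing : ∀ {A B : Set} (f : A → Maybe B) {x} →
                          f x ≡ nothing → length (mapMaybe f [ x ]) ≡ 0
length-mapMaybe-nothing f fx≡nothing rewrite fx≡nothing = refl

∑-mono-≤ : ∀ {k} {f g : Fin k → ℕ} → (∀ i → f i ≤ g i) → ∑[ i < k ] f i ≤ ∑[ i < k ] g i
∑-mono-≤ {zero}  f≤g = z≤n
∑-mono-≤ {suc k} f≤g = +-mono-≤ (f≤g zero) (∑-mono-≤ (f≤g ∘ suc))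

∑-single : ∀ {k} (f : Fin k → ℕ) l → (∀ i → i ≢ l → f i ≡ 0) → ∑[ i < k ] f i ≡ f l
∑-single {suc k} f l vanishes = begin
  ∑[ i < suc k ] f i                    ≡⟨ ∑.sum-remove {i = l} f ⟩
  f l + ∑[ j < k ] f (punchIn l j)
    ≡⟨ cong (f l +_) (∑.sum-cong-≗ λ j → vanishes _ (punchInᵢ≢i l j)) ⟩
  f l + ∑[ j < k ] 0                    ≡⟨ cong (f l +_) (∑.sum-replicate-zero k) ⟩
  f l + 0                               ≡⟨ +-identityʳ (f l) ⟩
  f l                                   ∎
  where open ≡-Reasoning

length-concatMap-tabulate : ∀ {k} {B C : Set} (f : Fin k → B) (F : B → List C) →
                            length (concatMap F (tabulate f)) ≡ ∑[ i < k ] length (F (f i))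
length-concatMap-tabulate {zero}  f F = refl
length-concatMap-tabulate {suc k} f F =
  trans (length-++ (F (f zero)))
        (cong (length (F (f zero)) +_) (length-concatMap-tabulate (f ∘ suc) F))

module _ {V : Set} {Adj : V → V → Set} {X : V → Set} {C : List V} where

  mvc-isVC : IsMVC Adj X C → IsVC Adj X C
  mvc-isVC (_ , isVC , _) = isVC

  mvc-minimal : IsMVC Adj X C → ∀ C′ → IsVC Adj X C′ → length C ≤ length C′
  mvc-minimal (_ , _ , minimal) = minimal

  module _ {M : V → Set} where

    xvc-isVC : IsXVC Adj X M C → IsVC Adj X C
    xvc-isVC (_ , isVC , _) = isVC

    xvc-⊇ : IsXVC Adj X M C → ∀ x → M x → x ∈ C
    xvc-⊇ (_ , _ , ⊇M , _) = ⊇M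

    xvc-minimal : IsXVC Adj X M C →
                  ∀ C′ → IsVC Adj X C′ → (∀ x → M x → x ∈ C′) → length C ≤ length C′
    xvc-minimal (_ , _ , _ , minimal) = minimal

module Composite (k : ℕ) (n : Fin k → ℕ) (G : (i : Fin k) → Graph (n i))
                 (nH : ℕ) (H : Graph nH)
                 (u : (i : Fin k) → Fin (n i)) (v : Fin k → Fin nH) where

  open Compose k n G nH H u v

  AdjJ-sym : Symmetric AdjJ
  AdjJ-sym (inG i x y p q e)  = inG i y x q p (Edge-sym (G i) e)
  AdjJ-sym (inH a b e)        = inH b a (Edge-sym H e)
  AdjJ-sym (glueˡ i x p e)    = glueʳ i x p e
  AdjJ-sym (glueʳ i x p e)    = glueˡ i x p e

  inj₁-cong : ∀ {i x y} {p : False (x ≟ u i)} {q : False (y ≟ u i)} →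
              x ≡ y → _≡_ {A = VJ} (inj₁ (i , x , p)) (inj₁ (i , y , q))
  inj₁-cong {i} {x} refl = cong (λ r → inj₁ (i , x , r)) (T-irrelevant _ _)

  projH : VJ → Fin nH
  projH (inj₁ (i , _)) = v i
  projH (inj₂ a)       = a

  projH-contract : ∀ {a b} → AdjJ a b → projH a ≡ projH b ⊎ Edge H (projH a) (projH b)
  projH-contract (inG _ _ _ _ _ _) = inj₁ refl
  projH-contract (inH _ _ e)       = inj₂ e
  projH-contract (glueˡ _ _ _ _)   = inj₁ refl
  projH-contract (glueʳ _ _ _ _)   = inj₁ refl

  projG : (i : Fin k) → VJ → Fin (n i)
  projG i (inj₁ (l , x , _)) with l ≟ i
  ... | yes refl = x
  ... | no _     = u i
  projG i (inj₂ _) = u i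

  projG-inj₁ : ∀ i x p → projG i (inj₁ (i , x , p)) ≡ x
  projG-inj₁ i x p with i ≟ i
  ... | yes refl = refl
  ... | no i≢i   = ⊥-elim (i≢i refl)

  projG-contract : ∀ i {a b} → AdjJ a b →
                   projG i a ≡ projG i b ⊎ Edge (G i) (projG i a) (projG i b)
  projG-contract i (inG l _ _ _ _ e) with l ≟ i
  ... | yes refl = inj₂ e
  ... | no _     = inj₁ refl
  projG-contract i (inH _ _ _) = inj₁ refl
  projG-contract i (glueˡ l _ _ e) with l ≟ i
  ... | yes refl = inj₂ e
  ... | no _     = inj₁ refl
  projG-contract i (glueʳ l _ _ e) with l ≟ i
  ... | yes refl = inj₂ (Edge-sym (G l) e)
  ... | no _     = inj₁ refl

  OnSide : Fin k → VJ → Set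
  OnSide i (inj₁ (l , _)) = l ≡ i
  OnSide i (inj₂ _)       = ⊥

  OnSide-projG : ∀ {i x} (p : False (x ≟ u i)) y →
                 OnSide i y → projG i y ≡ x → y ≡ inj₁ (i , x , p)
  OnSide-projG {i} p (inj₁ (.i , y , q)) refl y≡x =
    inj₁-cong (trans (sym (projG-inj₁ i y q)) y≡x)

  liftG-just : ∀ i x → x ≢ u i → ∃ λ y → liftG i x ≡ just y × OnSide i y × projG i y ≡ x
  liftG-just i x x≢u with x ≟ u i
  ... | yes x≡u = ⊥-elim (x≢u x≡u)
  ... | no x≢u′ = _ , refl , refl , projG-inj₁ i x (fromWitnessFalse x≢u′)

  liftG-≢ : ∀ i x (p : False (x ≟ u i)) → liftG i x ≡ just (inj₁ (i , x , p))
  liftG-≢ i x p with liftG-just i x (toWitnessFalse p)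
  ... | y , eq , on , proj = trans eq (cong just (OnSide-projG p y on proj))

  liftG-inj₂ : ∀ i x a → liftG i x ≢ just (inj₂ a)
  liftG-inj₂ i x a eq with x ≟ u i
  liftG-inj₂ i x a () | yes _
  liftG-inj₂ i x a () | no _

  embedG : (i : Fin k) → Fin (n i) → VJ
  embedG i x = fromMaybe (inj₂ (v i)) (liftG i x)

  embedG-≢ : ∀ i x (p : False (x ≟ u i)) → embedG i x ≡ inj₁ (i , x , p)
  embedG-≢ i x p = cong (fromMaybe (inj₂ (v i))) (liftG-≢ i x p)

  embedG-u : ∀ i → embedG i (u i) ≡ inj₂ (v i)
  embedG-u i with u i ≟ u i
  ... | yes _   = refl
  ... | no u≢u  = ⊥-elim (u≢u refl)

  embedG-hom : ∀ i {x y} → Edge (G i) x y → AdjJ (embedG i x) (embedG i y)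
  embedG-hom i {x} {y} e with x ≟ u i | y ≟ u i
  ... | yes refl | yes refl = ⊥-elim (Edge-irrefl (G i) e)
  ... | yes refl | no y≢u   = glueʳ i y _ (Edge-sym (G i) e)
  ... | no x≢u   | yes refl = glueˡ i x _ e
  ... | no x≢u   | no y≢u   = inG i x y _ _ e

  projG-embedG : ∀ i x → projG i (embedG i x) ≡ x
  projG-embedG i x with x ≟ u i
  ... | yes refl = refl
  ... | no x≢u   = projG-inj₁ i x (fromWitnessFalse x≢u)

  IsDist-inH : ∀ {a b d} → IsDist (Edge H) a b d → IsDist AdjJ (inj₂ a) (inj₂ b) d
  IsDist-inH = IsDist-retract inj₂ projH (inH _ _) projH-contract (λ _ → refl)

  IsDist-inG : ∀ i {x y d} → IsDist (Edge (G i)) x y d → IsDist AdjJ (embedG i x) (embedG i y) d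
  IsDist-inG i = IsDist-retract (embedG i) (projG i) (embedG-hom i) (projG-contract i) (projG-embedG i)

  leave-side : ∀ {i x p t m} → Walk AdjJ (inj₁ (i , x , p)) t m → ¬ OnSide i t →
               ∃₂ λ m₁ m₂ → m₁ + m₂ ≡ m ×
                 Walk (Edge (G i)) x (u i) m₁ × Walk AdjJ (inj₂ (v i)) t m₂
  leave-side (nil _) off = ⊥-elim (off refl)
  leave-side (cons (inG _ _ _ _ _ e) rest) off with leave-side rest off
  ... | m₁ , m₂ , refl , p , q = suc m₁ , m₂ , refl , cons e p , q
  leave-side (cons (glueˡ _ _ _ e) rest) off = 1 , _ , refl , cons e (nil _) , rest

  -- Every path leaving side i passes through v_i.
  IsDist-via-v : ∀ {i x t d₁ d₂} → IsDist (Edge (G i)) x (u i) d₁ →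
                 IsDist AdjJ (inj₂ (v i)) t d₂ → ¬ OnSide i t →
                 IsDist AdjJ (embedG i x) t (d₁ + d₂)
  IsDist-via-v {i} {x} px pt off with x ≟ u i
  ... | yes refl rewrite IsDist-unique px (IsDist-refl (u i)) = pt
  ... | no _     = via-v px pt off
    where
    via-v : ∀ {i x p t d₁ d₂} → IsDist (Edge (G i)) x (u i) d₁ →
            IsDist AdjJ (inj₂ (v i)) t d₂ → ¬ OnSide i t →
            IsDist AdjJ (inj₁ (i , x , p)) t (d₁ + d₂)
    via-v {i} {x} {p} {t} {d₁} {d₂} px (q , d₂-min) off = walk , lower-bound
      where
      walk : Walk AdjJ (inj₁ (i , x , p)) t (d₁ + d₂)
      walk = subst₂ (λ a b → Walk AdjJ a b d₁) (embedG-≢ i x p) (embedG-u i)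
                    (proj₁ (IsDist-inG i px))
             ++ʷ q
      lower-bound : ∀ m → Walk AdjJ (inj₁ (i , x , p)) t m → d₁ + d₂ ≤ m
      lower-bound m r with leave-side r off
      ... | m₁ , m₂ , refl , r₁ , r₂ = +-mono-≤ (proj₂ px m₁ r₁) (d₂-min m₂ r₂)

  neighbour-inj₁ : ∀ {i x p b} → AdjJ (inj₁ (i , x , p)) b →
                   ∃ λ z → Edge (G i) x z × embedG i z ≡ b
  neighbour-inj₁ (inG i _ z _ q e) = z , e , embedG-≢ i z q
  neighbour-inj₁ (glueˡ i _ _ e)   = u i , e , embedG-u i

  neighbour-inj₂ : ∀ {a b} → (∀ l → a ≢ v l) → AdjJ (inj₂ a) b →
                   ∃ λ c → Edge H a c × inj₂ c ≡ b
  neighbour-inj₂ unglued (inH _ c e)     = c , e , refl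
  neighbour-inj₂ unglued (glueʳ l _ _ _) = ⊥-elim (unglued l refl)

  module ConnectedFactors (n≥2 : ∀ i → 2 ≤ n i) (nH≥2 : 2 ≤ nH)
                          (G-connected : ∀ i → Connected (Edge (G i)))
                          (H-connected : Connected (Edge H)) where

    distG : ∀ i x y → ∃ (IsDist (Edge (G i)) x y)
    distG i = dist (G i) (G-connected i)

    distH : ∀ a b → ∃ (IsDist (Edge H) a b)
    distH = dist H H-connected

    IsDist-H-G : ∀ {i x p b dx db} →
                 IsDist (Edge (G i)) x (u i) dx → IsDist (Edge H) b (v i) db →
                 IsDist AdjJ (inj₂ b) (inj₁ (i , x , p)) (dx + db)
    IsDist-H-G {i} {x} {p} {b} {dx} {db} px pb =
      subst (λ s → IsDist AdjJ (inj₂ b) s (dx + db)) (embedG-≢ i x p)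
            (IsDist-sym AdjJ-sym (IsDist-via-v px (IsDist-inH (IsDist-sym (Edge-sym H) pb)) λ ()))

    distFromH : ∀ a t → ∃ (IsDist AdjJ (inj₂ a) t)
    distFromH a (inj₂ b)           = _ , IsDist-inH (proj₂ (distH a b))
    distFromH a (inj₁ (l , y , q)) =
      _ , IsDist-H-G (proj₂ (distG l y (u l))) (proj₂ (distH a (v l)))

    glue-not-maxDist-off : ∀ l s → ¬ OnSide l s → ¬ MaxDistFrom AdjJ (inj₂ (v l)) s
    glue-not-maxDist-off l s off h
      with neighbour (G l) (n≥2 l) (G-connected l) (u l) | distFromH (v l) s
    ... | z , e | R , pR = 1+n≰n (maxDistFrom-≤ h step farther pR)
      where
      step : AdjJ (inj₂ (v l)) (embedG l z)
      step = subst (λ a → AdjJ a (embedG l z)) (embedG-u l) (embedG-hom l e)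
      farther : IsDist AdjJ (embedG l z) s (1 + R)
      farther = IsDist-via-v (IsDist-edge (G l) (Edge-sym (G l) e)) pR off

    glue-not-maxDist-on : ∀ i x p → ¬ MaxDistFrom AdjJ (inj₂ (v i)) (inj₁ (i , x , p))
    glue-not-maxDist-on i x p h with neighbour H nH≥2 H-connected (v i) | distG i x (u i)
    ... | c , e | dx , px = 1+n≰n (+-cancelˡ-≤ dx 1 0 (maxDistFrom-≤ h (inH _ _ e) farther at-v))
      where
      farther : IsDist AdjJ (inj₂ c) (inj₁ (i , x , p)) (dx + 1)
      farther = IsDist-H-G px (IsDist-edge H (Edge-sym H e))
      at-v : IsDist AdjJ (inj₂ (v i)) (inj₁ (i , x , p)) (dx + 0)
      at-v = IsDist-H-G px (IsDist-refl (v i))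

    -- v_l always has a farther neighbour: in G_l if s lies off side l, and in H otherwise.
    glue-not-maxDist : ∀ l s → ¬ MaxDistFrom AdjJ (inj₂ (v l)) s
    glue-not-maxDist l (inj₁ (i , x , p)) with i ≟ l
    ... | yes refl = glue-not-maxDist-on i x p
    ... | no i≢l   = glue-not-maxDist-off l _ i≢l
    glue-not-maxDist l (inj₂ b) = glue-not-maxDist-off l _ λ ()

    maxDist-inH⁻ : ∀ {a b} → MaxDistFrom AdjJ (inj₂ a) (inj₂ b) → MaxDistFrom (Edge H) a b
    maxDist-inH⁻ h =
      ≤⇒maxDistFrom λ e pc pa → maxDistFrom-≤ h (inH _ _ e) (IsDist-inH pc) (IsDist-inH pa)

    maxDist-inH⁺ : ∀ {a b} → (∀ l → a ≢ v l) →
                   MaxDistFrom (Edge H) a b → MaxDistFrom AdjJ (inj₂ a) (inj₂ b)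
    maxDist-inH⁺ {a} {b} unglued h = ∃≤⇒maxDistFrom bound
      where
      bound : ∀ {s} → AdjJ (inj₂ a) s → NoFarther AdjJ s (inj₂ a) (inj₂ b)
      bound e with neighbour-inj₂ unglued e
      ... | c , ec , refl with distH c b | distH a b
      ... | _ , pc | _ , pa = _ , _ , IsDist-inH pc , IsDist-inH pa , maxDistFrom-≤ h ec pc pa

    maxDist-inG⁻ : ∀ {i x y p q} → MaxDistFrom AdjJ (inj₁ (i , x , p)) (inj₁ (i , y , q)) →
                   MaxDistFrom (Edge (G i)) x y
    maxDist-inG⁻ {i} {x} {y} {p} {q} h =
      ≤⇒maxDistFrom λ e pz px →
        maxDistFrom-≤ h′ (embedG-hom i e) (IsDist-inG i pz) (IsDist-inG i px)
      where
      h′ : MaxDistFrom AdjJ (embedG i x) (embedG i y)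
      h′ = subst₂ (MaxDistFrom AdjJ) (sym (embedG-≢ i x p)) (sym (embedG-≢ i y q)) h

    maxDist-inG⁺ : ∀ {i x y p q} → MaxDistFrom (Edge (G i)) x y →
                   MaxDistFrom AdjJ (inj₁ (i , x , p)) (inj₁ (i , y , q))
    maxDist-inG⁺ {i} {x} {y} {p} {q} h = ∃≤⇒maxDistFrom bound
      where
      bound : ∀ {s} → AdjJ (inj₁ (i , x , p)) s →
              NoFarther AdjJ s (inj₁ (i , x , p)) (inj₁ (i , y , q))
      bound e with neighbour-inj₁ e
      ... | z , ez , refl with distG i z y | distG i x y
      ... | dz , pz | dx , px =
        dz , dx ,
        subst (λ t → IsDist AdjJ (embedG i z) t dz) (embedG-≢ i y q) (IsDist-inG i pz) ,
        subst₂ (λ s t → IsDist AdjJ s t dx) (embedG-≢ i x p) (embedG-≢ i y q) (IsDist-inG i px) ,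
        maxDistFrom-≤ h ez pz px

    maxDist-across⁻ : ∀ {i x p t} → ¬ OnSide i t → MaxDistFrom AdjJ (inj₁ (i , x , p)) t →
                      MaxDistFrom (Edge (G i)) x (u i)
    maxDist-across⁻ {i} {x} {p} {t} off h with distFromH (v i) t
    ... | R , pR = ≤⇒maxDistFrom λ e pz px →
      +-cancelʳ-≤ R _ _
        (maxDistFrom-≤ h′ (embedG-hom i e) (IsDist-via-v pz pR off) (IsDist-via-v px pR off))
      where
      h′ : MaxDistFrom AdjJ (embedG i x) t
      h′ = subst (λ s → MaxDistFrom AdjJ s t) (sym (embedG-≢ i x p)) h

    maxDist-across⁺ : ∀ {i x p t} → ¬ OnSide i t → MaxDistFrom (Edge (G i)) x (u i) →
                      MaxDistFrom AdjJ (inj₁ (i , x , p)) t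
    maxDist-across⁺ {i} {x} {p} {t} off h = ∃≤⇒maxDistFrom bound
      where
      bound : ∀ {s} → AdjJ (inj₁ (i , x , p)) s → NoFarther AdjJ s (inj₁ (i , x , p)) t
      bound e with neighbour-inj₁ e
      ... | z , ez , refl with distG i z (u i) | distG i x (u i) | distFromH (v i) t
      ... | dz , pz | dx , px | R , pR =
        dz + R , dx + R ,
        IsDist-via-v pz pR off ,
        subst (λ s → IsDist AdjJ s t (dx + R)) (embedG-≢ i x p) (IsDist-via-v px pR off) ,
        +-monoˡ-≤ R (maxDistFrom-≤ h ez pz px)

    maxDist-H-G⁻ : ∀ {b i x p} → MaxDistFrom AdjJ (inj₂ b) (inj₁ (i , x , p)) →
                   MaxDistFrom (Edge H) b (v i)
    maxDist-H-G⁻ {i = i} {x} h with distG i x (u i)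
    ... | dx , px = ≤⇒maxDistFrom λ e pc pb →
      +-cancelˡ-≤ dx _ _ (maxDistFrom-≤ h (inH _ _ e) (IsDist-H-G px pc) (IsDist-H-G px pb))

    maxDist-H-G⁺ : ∀ {b i x p} → (∀ l → b ≢ v l) → MaxDistFrom (Edge H) b (v i) →
                   MaxDistFrom AdjJ (inj₂ b) (inj₁ (i , x , p))
    maxDist-H-G⁺ {b} {i} {x} {p} unglued h = ∃≤⇒maxDistFrom bound
      where
      bound : ∀ {s} → AdjJ (inj₂ b) s → NoFarther AdjJ s (inj₂ b) (inj₁ (i , x , p))
      bound e with neighbour-inj₂ unglued e
      ... | c , ec , refl with distH c (v i) | distH b (v i) | distG i x (u i)
      ... | _ , pc | _ , pb | dx , px =
        _ , _ , IsDist-H-G px pc , IsDist-H-G px pb , +-monoʳ-≤ dx (maxDistFrom-≤ h ec pc pb)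

module Main (k : ℕ) (n : Fin k → ℕ) (G : (i : Fin k) → Graph (n i))
            (nH : ℕ) (H : Graph nH)
            (u : (i : Fin k) → Fin (n i)) (v : Fin k → Fin nH) (w : Fin nH)
            (n≥2 : ∀ i → 2 ≤ n i) (nH≥2 : 2 ≤ nH)
            (G-connected : ∀ i → Connected (Edge (G i))) (H-connected : Connected (Edge H))
            (CH : List (Fin nH)) (CH-mvc : IsMVC (Edge H) (VWSet v w) CH)
            (DH : Fin k → List (Fin nH))
            (DH-xvc : ∀ j → IsXVC (Edge H) (VWSet v w) (MDminus (Edge H) (v j) (VWSet v w)) (DH j))
            (CG : (i : Fin k) → List (Fin (n i)))
            (CG-xvc : ∀ i → IsXVC (Edge (G i)) (λ x → x ≡ u i) (MD (Edge (G i)) (u i)) (CG i))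
            (DG : (i : Fin k) → List (Fin (n i)))
            (DG-mvc : ∀ i → IsMVC (Edge (G i)) (λ x → x ≡ u i) (DG i)) where

  open Compose k n G nH H u v
  open Composite k n G nH H u v
  open ConnectedFactors n≥2 nH≥2 G-connected H-connected
  open Covers k n G nH H u v CH DH CG DG

  X : Fin nH → Set
  X = VWSet v w

  X? : Decidable X
  X? a = any? (λ j → a ≟ v j) ⊎-dec (a ≟ w)

  Xᴶ : VJ → Set
  Xᴶ s = s ≡ inj₂ w

  hList-isVC : ∀ t → IsVC (Edge H) X (hList t)
  hList-isVC zero    = mvc-isVC CH-mvc
  hList-isVC (suc j) = xvc-isVC (DH-xvc j)

  gList-isVC : ∀ t i → IsVC (Edge (G i)) (λ x → x ≡ u i) (gList t i)
  gList-isVC zero    i = xvc-isVC (CG-xvc i)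
  gList-isVC (suc j) i with i ≟ j
  ... | yes _ = mvc-isVC (DG-mvc i)
  ... | no _  = xvc-isVC (CG-xvc i)

  gList-⊇MD : ∀ t i → t ≢ suc i → ∀ x → MD (Edge (G i)) (u i) x → x ∈ gList t i
  gList-⊇MD zero    i _ = xvc-⊇ (CG-xvc i)
  gList-⊇MD (suc j) i t≢ with i ≟ j
  ... | yes refl = ⊥-elim (t≢ refl)
  ... | no _     = xvc-⊇ (CG-xvc i)

  ∈U-H : ∀ t {a} → a ∈ hList t → inj₂ a ∈ U t
  ∈U-H t a∈ = ∈-++⁺ˡ (∈-map⁺ inj₂ a∈)

  ∈U-G : ∀ t {i x} p → x ∈ gList t i → inj₁ (i , x , p) ∈ U t
  ∈U-G t {i} {x} p x∈ =
    ∈-++⁺ʳ (map inj₂ (hList t))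
           (∈-concatMap⁺ (λ i → liftGs i (gList t i))
                         (lose (∈-allFin i) (∈-mapMaybe⁺ (liftG i) x∈ (liftG-≢ i x p))))

  MD-in-U : ∀ t {i x} p → t ≢ suc i → MaxDistFrom (Edge (G i)) x (u i) → inj₁ (i , x , p) ∈ U t
  MD-in-U t {i} {x} p t≢ md = ∈U-G t p (gList-⊇MD t i t≢ x md)

  U-avoids : ∀ t s → s ∈ U t → ¬ Xᴶ s
  U-avoids t s s∈ refl with ∈-++⁻ (map inj₂ (hList t)) s∈
  ... | inj₁ w∈ with ∈-map⁻ inj₂ w∈
  ...   | a , a∈ , refl = proj₁ (hList-isVC t) a a∈ (inj₂ refl)
  U-avoids t s s∈ refl | inj₂ w∈
    with satisfied (∈-concatMap⁻ (λ i → liftGs i (gList t i)) {xs = allFin k} w∈)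
  ... | i , w∈′ with ∈-mapMaybe⁻ (liftG i) (gList t i) w∈′
  ...   | x , _ , eq = liftG-inj₂ i x w eq

  unremoved-H : ∀ {b s} → ¬ Xᴶ (inj₂ b) → MaxDistFrom AdjJ (inj₂ b) s → ¬ X b
  unremoved-H b≢w h (inj₁ (l , refl)) = glue-not-maxDist l _ h
  unremoved-H b≢w h (inj₂ refl)       = b≢w refl

  G-H-covered : ∀ t i x p b → ¬ Xᴶ (inj₂ b) →
                MaxDistFrom AdjJ (inj₁ (i , x , p)) (inj₂ b) → MaxDistFrom AdjJ (inj₂ b) (inj₁ (i , x , p)) →
                inj₁ (i , x , p) ∈ U t ⊎ inj₂ b ∈ U t
  G-H-covered t i x p b b∉ h₁ h₂ with t ≟ suc i
  ... | yes refl = inj₂ (∈U-H t (xvc-⊇ (DH-xvc i) b (maxDist-H-G⁻ h₂ , unremoved-H b∉ h₂)))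
  ... | no t≢    = inj₁ (MD-in-U t p t≢ (maxDist-across⁻ (λ ()) h₁))

  U-covers : ∀ t s s′ → ¬ Xᴶ s → ¬ Xᴶ s′ → SREdge AdjJ s s′ → s ∈ U t ⊎ s′ ∈ U t
  U-covers t (inj₂ a) (inj₂ b) a∉ b∉ (a≢b , h₁ , h₂) =
    Sum.map (∈U-H t) (∈U-H t)
      (proj₂ (hList-isVC t) a b (unremoved-H a∉ h₁) (unremoved-H b∉ h₂)
             (a≢b ∘ cong inj₂ , maxDist-inH⁻ h₁ , maxDist-inH⁻ h₂))
  U-covers t (inj₁ (i , x , p)) (inj₂ b) _ b∉ (_ , h₁ , h₂) = G-H-covered t i x p b b∉ h₁ h₂
  U-covers t (inj₂ b) (inj₁ (i , x , p)) b∉ _ (_ , h₁ , h₂) =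
    Sum.swap (G-H-covered t i x p b b∉ h₂ h₁)
  U-covers t (inj₁ (i , x , p)) (inj₁ (l , y , q)) _ _ (x≢y , h₁ , h₂) with i ≟ l | t ≟ suc i
  ... | yes refl | _ =
    Sum.map (∈U-G t p) (∈U-G t q)
      (proj₂ (gList-isVC t i) x y (toWitnessFalse p) (toWitnessFalse q)
             (x≢y ∘ inj₁-cong , maxDist-inG⁻ h₁ , maxDist-inG⁻ h₂))
  ... | no i≢l | no t≢    = inj₁ (MD-in-U t p t≢ (maxDist-across⁻ (i≢l ∘ sym) h₁))
  ... | no i≢l | yes refl = inj₂ (MD-in-U t q (i≢l ∘ suc-injective) (maxDist-across⁻ i≢l h₂))

  U-isVC : ∀ t → IsVC AdjJ Xᴶ (U t)
  U-isVC t = U-avoids t , U-covers t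

  projᴴ : VJ → Maybe (Fin nH)
  projᴴ (inj₁ _) = nothing
  projᴴ (inj₂ a) with X? a
  ... | yes _ = nothing
  ... | no _  = just a

  projᴴ-just : ∀ s a → projᴴ s ≡ just a → ¬ X a
  projᴴ-just (inj₂ b) a eq with X? b
  projᴴ-just (inj₂ b) a ()   | yes _
  projᴴ-just (inj₂ b) b refl | no b∉ = b∉

  projᴴ-inj₂ : ∀ {a} → ¬ X a → projᴴ (inj₂ a) ≡ just a
  projᴴ-inj₂ {a} a∉ with X? a
  ... | yes a∈ = ⊥-elim (a∉ a∈)
  ... | no _   = refl

  projᴳ : (i : Fin k) → VJ → Maybe (Fin (n i))
  projᴳ i (inj₁ (l , x , _)) with l ≟ i
  ... | yes refl = just x
  ... | no _     = nothing
  projᴳ i (inj₂ _) = nothing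

  projᴳ-just : ∀ i s x → projᴳ i s ≡ just x → x ≢ u i
  projᴳ-just i (inj₁ (l , y , q)) x eq with l ≟ i
  projᴳ-just i (inj₁ (i , y , q)) y refl | yes refl = toWitnessFalse q
  projᴳ-just i (inj₁ (l , y , q)) x ()   | no _

  projᴳ-inj₁ : ∀ {i x} p → projᴳ i (inj₁ (i , x , p)) ≡ just x
  projᴳ-inj₁ {i} p with i ≟ i
  ... | yes refl = refl
  ... | no i≢i   = ⊥-elim (i≢i refl)

  projᴳ-other : ∀ {i l x} p → l ≢ i → projᴳ i (inj₁ (l , x , p)) ≡ nothing
  projᴳ-other {i} {l} p l≢i with l ≟ i
  ... | yes l≡i = ⊥-elim (l≢i l≡i)
  ... | no _    = refl

  total-length : List (Fin nH) → ((i : Fin k) → List (Fin (n i))) → ℕ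
  total-length h g = length h + ∑[ i < k ] length (g i)

  total-length-mono : ∀ h h′ g g′ →
                      length h ≤ length h′ → (∀ i → length (g i) ≤ length (g′ i)) →
                      total-length h g ≤ total-length h′ g′
  total-length-mono _ _ _ _ h≤ g≤ = +-mono-≤ h≤ (∑-mono-≤ g≤)

  length-U : ∀ t → length (U t) ≤ total-length (hList t) (gList t)
  length-U t = begin
    length (U t)
      ≡⟨ length-++ (map inj₂ (hList t)) ⟩
    length (map inj₂ (hList t)) + length (concatMap (λ i → liftGs i (gList t i)) (allFin k))
      ≡⟨ cong₂ _+_ (length-map inj₂ (hList t))
                   (length-concatMap-tabulate (λ i → i) (λ i → liftGs i (gList t i))) ⟩
    length (hList t) + ∑[ i < k ] length (liftGs i (gList t i))
      ≤⟨ +-monoʳ-≤ (length (hList t)) (∑-mono-≤ λ i → length-mapMaybe (liftG i) (gList t i)) ⟩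
    total-length (hList t) (gList t) ∎
    where open ≤-Reasoning


  hPart : List VJ → List (Fin nH)
  hPart = mapMaybe projᴴ

  gPart : List VJ → (i : Fin k) → List (Fin (n i))
  gPart C i = mapMaybe (projᴳ i) C

  total-length-∷ : ∀ s C → total-length (hPart (s ∷ C)) (gPart (s ∷ C))
                           ≡ total-length (hPart [ s ]) (gPart [ s ]) + total-length (hPart C) (gPart C)
  total-length-∷ s C = trans
    (cong₂ _+_ (length-mapMaybe-∷ projᴴ s C)
               (trans (∑.sum-cong-≗ {k} λ i → length-mapMaybe-∷ (projᴳ i) s C)
                      (∑.∑-distrib-+ (λ i → length (gPart [ s ] i)) (λ i → length (gPart C i)))))
    (interchange (length (hPart [ s ])) (length (hPart C)) _ _)

  total-length-[_] : ∀ s → total-length (hPart [ s ]) (gPart [ s ]) ≤ 1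
  total-length-[ inj₂ a ] = begin
    length (hPart [ inj₂ a ]) + ∑[ i < k ] 0
      ≡⟨ cong (length (hPart [ inj₂ a ]) +_) (∑.sum-replicate-zero k) ⟩
    length (hPart [ inj₂ a ]) + 0            ≡⟨ +-identityʳ _ ⟩
    length (hPart [ inj₂ a ])                ≤⟨ length-mapMaybe projᴴ [ inj₂ a ] ⟩
    1                                        ∎
    where open ≤-Reasoning
  total-length-[ inj₁ (l , x , p) ] = begin
    ∑[ i < k ] length (gPart [ inj₁ (l , x , p) ] i)
      ≡⟨ ∑-single (λ i → length (gPart [ inj₁ (l , x , p) ] i)) l
                  (λ i i≢l → length-mapMaybe-nothing (projᴳ i) {inj₁ (l , x , p)}
                                                     (projᴳ-other p (i≢l ∘ sym))) ⟩
    length (gPart [ inj₁ (l , x , p) ] l)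
      ≤⟨ length-mapMaybe (projᴳ l) [ inj₁ (l , x , p) ] ⟩
    1 ∎
    where open ≤-Reasoning

  total-length-parts : ∀ C → total-length (hPart C) (gPart C) ≤ length C
  total-length-parts []      = ≤-reflexive (∑.sum-replicate-zero k)
  total-length-parts (s ∷ C) =
    ≤-trans (≤-reflexive (total-length-∷ s C))
            (+-mono-≤ total-length-[ s ] (total-length-parts C))

  ¬X⇒¬Xᴶ : ∀ {a} → ¬ X a → ¬ Xᴶ (inj₂ a)
  ¬X⇒¬Xᴶ a∉ refl = a∉ (inj₂ refl)

  ¬X⇒unglued : ∀ {a} → ¬ X a → ∀ l → a ≢ v l
  ¬X⇒unglued a∉ l a≡v = a∉ (inj₁ (l , a≡v))

  MaxDistFrom-≢u : ∀ {i x} → MaxDistFrom (Edge (G i)) x (u i) → x ≢ u i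
  MaxDistFrom-≢u {i} h refl = not-maxDistFrom-self (G i) (n≥2 i) (G-connected i) (u i) h

  _≟ᴶ_ : DecidableEquality VJ
  _≟ᴶ_ = Sum.≡-dec (Product.≡-dec _≟_ (Product.≡-dec _≟_ λ p q → yes (T-irrelevant p q)))
                   _≟_

  module Cover (C : List VJ) (C-isVC : IsVC AdjJ Xᴶ C) where

    open import Data.List.Membership.DecPropositional _≟ᴶ_ using (_∈?_; _∉_)

    hPart-isVC : IsVC (Edge H) X (hPart C)
    hPart-isVC = avoids , covers
      where
      avoids : ∀ a → a ∈ hPart C → ¬ X a
      avoids a a∈ with ∈-mapMaybe⁻ projᴴ C a∈
      ... | s , _ , eq = projᴴ-just s a eq
      covers : ∀ a b → ¬ X a → ¬ X b → SREdge (Edge H) a b → a ∈ hPart C ⊎ b ∈ hPart C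
      covers a b a∉ b∉ (a≢b , h₁ , h₂) =
        Sum.map (λ a∈ → ∈-mapMaybe⁺ projᴴ a∈ (projᴴ-inj₂ a∉))
                (λ b∈ → ∈-mapMaybe⁺ projᴴ b∈ (projᴴ-inj₂ b∉))
          (proj₂ C-isVC (inj₂ a) (inj₂ b) (¬X⇒¬Xᴶ a∉) (¬X⇒¬Xᴶ b∉)
                 ((λ { refl → a≢b refl }) ,
                  maxDist-inH⁺ (¬X⇒unglued a∉) h₁ , maxDist-inH⁺ (¬X⇒unglued b∉) h₂))

    gPart-isVC : ∀ i → IsVC (Edge (G i)) (λ x → x ≡ u i) (gPart C i)
    gPart-isVC i = avoids , covers
      where
      avoids : ∀ x → x ∈ gPart C i → x ≢ u i
      avoids x x∈ with ∈-mapMaybe⁻ (projᴳ i) C x∈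
      ... | s , _ , eq = projᴳ-just i s x eq
      covers : ∀ x y → x ≢ u i → y ≢ u i → SREdge (Edge (G i)) x y →
               x ∈ gPart C i ⊎ y ∈ gPart C i
      covers x y x≢u y≢u (x≢y , h₁ , h₂) =
        Sum.map (λ x∈ → ∈-mapMaybe⁺ (projᴳ i) x∈ (projᴳ-inj₁ p))
                (λ y∈ → ∈-mapMaybe⁺ (projᴳ i) y∈ (projᴳ-inj₁ q))
          (proj₂ C-isVC (inj₁ (i , x , p)) (inj₁ (i , y , q)) (λ ()) (λ ())
                 ((λ { refl → x≢y refl }) , maxDist-inG⁺ h₁ , maxDist-inG⁺ h₂))
        where
        p = fromWitnessFalse x≢u
        q = fromWitnessFalse y≢u

    gPart-⊇MD : ∀ i → (∀ x p → MaxDistFrom (Edge (G i)) x (u i) → inj₁ (i , x , p) ∈ C) →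
                ∀ x → MD (Edge (G i)) (u i) x → x ∈ gPart C i
    gPart-⊇MD i all-in x md = ∈-mapMaybe⁺ (projᴳ i) (all-in x p md) (projᴳ-inj₁ p)
      where
      p = fromWitnessFalse (MaxDistFrom-≢u md)

    U-zero-≤ : (∀ i x p → MaxDistFrom (Edge (G i)) x (u i) → inj₁ (i , x , p) ∈ C) →
               length (U zero) ≤ length C
    U-zero-≤ all-in = begin
      length (U zero)                   ≤⟨ length-U zero ⟩
      total-length CH CG                ≤⟨ total-length-mono CH (hPart C) CG (gPart C) CH≤ CG≤ ⟩
      total-length (hPart C) (gPart C)  ≤⟨ total-length-parts C ⟩
      length C                          ∎
      where
      open ≤-Reasoning
      CH≤ : length CH ≤ length (hPart C)
      CH≤ = mvc-minimal CH-mvc (hPart C) hPart-isVC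
      CG≤ : ∀ i → length (CG i) ≤ length (gPart C i)
      CG≤ i = xvc-minimal (CG-xvc i) (gPart C i) (gPart-isVC i) (gPart-⊇MD i (all-in i))

    U-suc-≤ : ∀ j x p → MaxDistFrom (Edge (G j)) x (u j) → inj₁ (j , x , p) ∉ C →
              length (U (suc j)) ≤ length C
    U-suc-≤ j x p md x∉ = begin
      length (U (suc j))                       ≤⟨ length-U (suc j) ⟩
      total-length (DH j) (gList (suc j))
        ≤⟨ total-length-mono (DH j) (hPart C) (gList (suc j)) (gPart C) DH≤ gList≤ ⟩
      total-length (hPart C) (gPart C)         ≤⟨ total-length-parts C ⟩
      length C                                 ∎
      where
      open ≤-Reasoning
      forced : ∀ s → ¬ Xᴶ s → inj₁ (j , x , p) ≢ s →
               MaxDistFrom AdjJ (inj₁ (j , x , p)) s → MaxDistFrom AdjJ s (inj₁ (j , x , p)) →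
               s ∈ C
      forced s s∉ ≢s h₁ h₂ with proj₂ C-isVC (inj₁ (j , x , p)) s (λ ()) s∉ (≢s , h₁ , h₂)
      ... | inj₁ x∈ = ⊥-elim (x∉ x∈)
      ... | inj₂ s∈ = s∈

      H-MD-in : ∀ b → MDminus (Edge H) (v j) X b → b ∈ hPart C
      H-MD-in b (md-b , b∉) =
        ∈-mapMaybe⁺ projᴴ
          (forced (inj₂ b) (¬X⇒¬Xᴶ b∉) (λ ()) (maxDist-across⁺ (λ ()) md)
                  (maxDist-H-G⁺ (¬X⇒unglued b∉) md-b))
          (projᴴ-inj₂ b∉)

      DH≤ : length (DH j) ≤ length (hPart C)
      DH≤ = xvc-minimal (DH-xvc j) (hPart C) hPart-isVC H-MD-in

      gList≤ : ∀ i → length (gList (suc j) i) ≤ length (gPart C i)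
      gList≤ i with i ≟ j
      ... | yes refl = mvc-minimal (DG-mvc i) (gPart C i) (gPart-isVC i)
      ... | no i≢j   =
        xvc-minimal (CG-xvc i) (gPart C i) (gPart-isVC i) (gPart-⊇MD i λ y q md-y →
          forced (inj₁ (i , y , q)) (λ ()) (λ { refl → i≢j refl })
                 (maxDist-across⁺ i≢j md) (maxDist-across⁺ (i≢j ∘ sym) md-y))

    -- Membership in MD is not decidable, so "C contains every lifted MD_{G_i}(u_i) or misses one"
    -- is only available under double negation; that suffices because _≤_ is decidable.
    some-U-≤ : ¬ ¬ (∃ λ t → length (U t) ≤ length C)
    some-U-≤ none = none (zero , U-zero-≤ all-in)
      where
      all-in : ∀ i x p → MaxDistFrom (Edge (G i)) x (u i) → inj₁ (i , x , p) ∈ C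
      all-in i x p md with inj₁ (i , x , p) ∈? C
      ... | yes x∈ = x∈
      ... | no x∉  = ⊥-elim (none (suc i , U-suc-≤ i x p md x∉))

  shortest : Fin (suc k)
  shortest = argmin (length ∘ U) zero (allFin (suc k))

  U-shortest-≤ : ∀ t → length (U shortest) ≤ length (U t)
  U-shortest-≤ t =
    All.lookup (f[argmin]≤f[xs] {f = length ∘ U} zero (allFin (suc k))) (∈-allFin t)

  U-shortest-isMinVC : IsMinVC AdjJ Xᴶ (U shortest)
  U-shortest-isMinVC = U-isVC shortest , λ C C-isVC →
    decidable-stable (length (U shortest) ≤? length C) λ ≰ →
      Cover.some-U-≤ C C-isVC λ (t , ≤C) → ≰ (≤-trans (U-shortest-≤ t) ≤C)

lemma8 : (k : ℕ) → 1 ≤ k →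
         (n : Fin k → ℕ) (G : (i : Fin k) → Graph (n i)) (nH : ℕ) (H : Graph nH) →
         (∀ i → 2 ≤ n i) → 2 ≤ nH →
         (∀ i → Connected (Edge (G i))) → Connected (Edge H) →
         (u : (i : Fin k) → Fin (n i)) (v : Fin k → Fin nH) (w : Fin nH) →
         (CH : List (Fin nH)) → IsMVC (Edge H) (VWSet v w) CH →
         (DH : Fin k → List (Fin nH)) →
         (∀ j → IsXVC (Edge H) (VWSet v w) (MDminus (Edge H) (v j) (VWSet v w)) (DH j)) →
         (CG : (i : Fin k) → List (Fin (n i))) →
         (∀ i → IsXVC (Edge (G i)) (λ x → x ≡ u i) (MD (Edge (G i)) (u i)) (CG i)) →
         (DG : (i : Fin k) → List (Fin (n i))) →
         (∀ i → IsMVC (Edge (G i)) (λ x → x ≡ u i) (DG i)) →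
         (∀ t → IsVC (Compose.AdjJ k n G nH H u v) (λ x → x ≡ inj₂ w)
                     (Covers.U k n G nH H u v CH DH CG DG t))
         × ∃ (λ t → IsMinVC (Compose.AdjJ k n G nH H u v) (λ x → x ≡ inj₂ w)
                            (Covers.U k n G nH H u v CH DH CG DG t))
lemma8 k _ n G nH H n≥2 nH≥2 G-connected H-connected u v w CH CH-mvc DH DH-xvc CG CG-xvc DG DG-mvc =
  U-isVC , shortest , U-shortest-isMinVC
  where
  open Main k n G nH H u v w n≥2 nH≥2 G-connected H-connected CH CH-mvc DH DH-xvc CG CG-xvc DG DG-mvc
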